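{- Let $L$ be a finite lattice with distinct bottom $\widehat 0$ and top $\widehat 1$. Suppose there exists $x\in L\setminus\{\widehat 0,\widehat 1\}$ such that $|J_x|\geq |J_y|$ for all $y\in L\setminus\{\widehat 0,\widehat 1\}$ and $|J_x|$ does not divide $|J|$. Then $L$ is not weakly coset-like.
   Context: $J$ denotes the set of join-irreducible elements of $L$ (elements $x\neq\widehat 0$ such that $x=a\vee b$ implies $a=x$ or $b=x$), and $J_x=\{j\in J: j\leq x\}$. Let $\mu$ be the Möbius function of the poset $L$ ($\mu(x,x)=1$, $\mu(y,x)=-\sum_{y<z\leq x}\mu(z,x)$ for $y<x$). The probabilistic zeta function is $P(L,s)=\sum_{x\in L\setminus\{\widehat 0\}}\mu(x,\widehat 1)\,(|J|/|J_x|)^{ -s}$, a finite sum of terms $c\,\lambda^{ -s}$ with rational $\lambda\geq 1$. $L$ is weakly coset-like if $P(L,s)$ is a finite ordinary Dirichlet series, i.e. after collecting terms with equal $\lambda$, every $\lambda$ with nonzero total coefficient is an integer. -}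

module Defs where

open import Level using (0ℓ)
open import Data.Nat as ℕ using (ℕ; zero; suc; NonZero)
open import Data.Integer as ℤ using (ℤ; +_)
open import Data.Fin using (Fin)
open import Data.Fin.Properties as FinP using (all?)
open import Data.List using (List; filter; length; foldr)
open import Data.List.Base using (map)
open import Data.Product using (Σ; ∃; _×_; _,_)
open import Data.Sum using (_⊎_)
open import Data.Rational as ℚ using (ℚ; 0ℚ; _/_)
open import Data.Rational.Properties as ℚP using ()
open import Data.Vec.Functional using ()
open import Relation.Nullary using (Dec; yes; no; ¬_; does)
open import Relation.Nullary.Decidable using (¬?; _×-dec_; _⊎-dec_; _→-dec_)
open import Relation.Binary using (Rel; Decidable)
open import Relation.Binary.Lattice.Structures using (IsBoundedLattice)
open import Relation.Binary.PropositionalEquality using (_≡_; _≢_)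
open import Data.Bool using (if_then_else_)
open import Data.List using (allFin)

record FiniteLattice : Set₁ where
  field
    n      : ℕ
    _≤_    : Rel (Fin n) 0ℓ
    _≤?_   : Decidable _≤_
    _∨_    : Fin n → Fin n → Fin n
    _∧_    : Fin n → Fin n → Fin n
    ⊤      : Fin n
    ⊥      : Fin n
    isBoundedLattice : IsBoundedLattice _≡_ _≤_ _∨_ _∧_ ⊤ ⊥

module _ (L : FiniteLattice) where
  open FiniteLattice L

  private
    _≟_ : Decidable {A = Fin n} _≡_
    _≟_ = FinP._≟_

  JoinIrreducible : Fin n → Set
  JoinIrreducible j = (j ≢ ⊥) × (∀ a b → j ≡ a ∨ b → (a ≡ j) ⊎ (b ≡ j))

  joinIrreducible? : (j : Fin n) → Dec (JoinIrreducible j)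
  joinIrreducible? j =
    ¬? (j ≟ ⊥) ×-dec
    all? (λ a → all? (λ b → (j ≟ (a ∨ b)) →-dec ((a ≟ j) ⊎-dec (b ≟ j))))

  J : List (Fin n)
  J = filter joinIrreducible? (allFin n)

  J≤ : Fin n → List (Fin n)
  J≤ x = filter (λ j → joinIrreducible? j ×-dec (j ≤? x)) (allFin n)

  ∣J∣ : ℕ
  ∣J∣ = length J

  ∣J_∣ : Fin n → ℕ
  ∣J_∣ x = length (J≤ x)

  sumℤ : List ℤ → ℤ
  sumℤ = foldr ℤ._+_ (+ 0)

  -- The recursion is computed with fuel; fuel n (= |L|) exceeds the length
  -- of every chain, so μ below is the exact Möbius function.
  μ-fuel : ℕ → Fin n → Fin n → ℤ
  μ-fuel zero    y x = + 0
  μ-fuel (suc k) y x with y ≟ x | y ≤? x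
  ... | yes _ | _     = + 1
  ... | no  _ | no _  = + 0
  ... | no  _ | yes _ = ℤ.- sumℤ (map (λ z → μ-fuel k z x)
                          (filter (λ z → ((y ≤? z) ×-dec ¬? (y ≟ z)) ×-dec (z ≤? x))
                                  (allFin n)))

  μ : Fin n → Fin n → ℤ
  μ y x = μ-fuel n y x

  -- λ_x = |J| / |J_x| as a rational (|J_x| ≠ 0 for x ≠ 0̂; the value 0
  -- in the impossible case |J_x| = 0 is never used for x ≠ 0̂).
  ratio : Fin n → ℚ
  ratio x with ∣J_∣ x
  ... | zero  = 0ℚ
  ... | suc m = (+ ∣J∣) / suc m

  -- total coefficient of λ^{-s} in P(L,s) = Σ_{x ≠ 0̂} μ(x,1̂) (|J|/|J_x|)^{-s}
  coeff : ℚ → ℤ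
  coeff q = sumℤ (map (λ x → μ x ⊤)
              (filter (λ x → ¬? (x ≟ ⊥) ×-dec (ratio x ℚP.≟ q)) (allFin n)))

  IsInteger : ℚ → Set
  IsInteger q = ∃ λ (k : ℤ) → q ≡ k / 1

  WeaklyCosetLike : Set
  WeaklyCosetLike = ∀ (q : ℚ) → coeff q ≢ + 0 → IsInteger q

{-# OPTIONS --safe #-}
-- Put q = |J| / |J_x|. A join-irreducible below z but not below y exists whenever
-- z ≰ y, so |J_y| grows strictly along y < z. Hence every y ≠ 0̂ with
-- |J| / |J_y| = q, i.e. |J_y| = |J_x|, is a coatom by maximality of |J_x|
-- (and y ≠ 1̂ because |J_x| ∤ |J| = |J_1̂|). Coatoms have μ(y, 1̂) = -1, so the
-- coefficient of q^(-s) in P(L, s) is negative, yet q is not an integer.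
module Submission where

open import Defs
open import Data.Fin using (Fin)
open import Data.Nat using (_≤_)
open import Data.Nat.Divisibility using (_∣_)
open import Relation.Nullary using (¬_)
open import Relation.Binary.PropositionalEquality using (_≢_)

open import Data.Empty using (⊥-elim)
open import Data.Fin.Properties using (_≟_; ¬∀⟶∃¬; all?)
open import Data.Integer as ℤ using (ℤ; +_; -[1+_])
import Data.Integer.Properties as ℤ
open import Data.Integer.Divisibility.Signed using (divides; ∣⇒∣ᵤ)
open import Data.List using (List; _∷_; filter; length; foldr; allFin)
open import Data.List.Properties using (filter-≐)
open import Data.List.Membership.Propositional using (_∈_)
open import Data.List.Membership.Propositional.Properties using (∈-filter⁺; ∈-filter⁻; ∈-allFin)
open import Data.List.Relation.Binary.Sublist.Propositional using (⊆-refl)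
open import Data.List.Relation.Binary.Sublist.Propositional.Properties using (filter⁺; length-mono-≤)
open import Data.List.Relation.Unary.All as All using (All; []; _∷_)
import Data.List.Relation.Unary.All.Properties as All
open import Data.List.Relation.Unary.Any as Any using (Any; here; there)
import Data.List.Relation.Unary.Any.Properties as Any
open import Data.Nat as ℕ using (ℕ; zero; suc; _<_; z≤n; s≤s)
import Data.Nat.Properties as ℕ
open import Data.Nat.Divisibility using (∣-refl; _∣0)
open import Data.Nat.Induction using (<-wellFounded)
open import Data.Product using (∃; ∃₂; _×_; _,_; proj₁; proj₂)
open import Data.Rational as ℚ using (0ℚ; _/_)
import Data.Rational.Properties as ℚ
open import Data.Rational.Unnormalised using (mkℚᵘ; *≡*)
open import Data.Sum using (_⊎_; inj₁; inj₂)
open import Function using (_∘_)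
open import Induction.WellFounded using (WellFounded; Acc; acc; module Subrelation)
open import Level using (0ℓ)
open import Relation.Binary.Core using (Rel)
import Relation.Binary.Construct.On as On
open import Relation.Binary.Lattice.Structures using (IsBoundedLattice)
open import Relation.Binary.PropositionalEquality using (_≡_; refl; sym; trans; cong; subst)
open import Relation.Nullary using (yes; no)
open import Relation.Nullary.Decidable using (Dec; ¬?; decidable-stable; _×-dec_; _→-dec_; _⊎-dec_)
import Relation.Unary as U

sum : List ℤ → ℤ
sum = foldr ℤ._+_ (+ 0)

sum-nonneg : ∀ {zs} → All (+ 0 ℤ.≤_) zs → + 0 ℤ.≤ sum zs
sum-nonneg []       = ℤ.+≤+ z≤n
sum-nonneg (p ∷ ps) = ℤ.+-mono-≤ p (sum-nonneg ps)

sum-positive : ∀ {zs} → All (+ 0 ℤ.≤_) zs → Any (+ 1 ℤ.≤_) zs → + 1 ℤ.≤ sum zs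
sum-positive (_ ∷ ps) (here q)  = ℤ.+-mono-≤ q (sum-nonneg ps)
sum-positive (p ∷ ps) (there q) = ℤ.+-mono-≤ p (sum-positive ps q)

sum-nonpos : ∀ {zs} → All (ℤ._≤ + 0) zs → sum zs ℤ.≤ + 0
sum-nonpos []       = ℤ.+≤+ z≤n
sum-nonpos (p ∷ ps) = ℤ.+-mono-≤ p (sum-nonpos ps)

sum-negative : ∀ {zs} → All (ℤ._≤ + 0) zs → Any (ℤ._≤ -[1+ 0 ]) zs → sum zs ℤ.≤ -[1+ 0 ]
sum-negative (_ ∷ ps) (here q)  = ℤ.+-mono-≤ q (sum-nonpos ps)
sum-negative (p ∷ ps) (there q) = ℤ.+-mono-≤ p (sum-negative ps q)

module _ {A : Set} {P Q : U.Pred A 0ℓ} (P? : U.Decidable P) (Q? : U.Decidable Q)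
         (P⊆Q : ∀ {x} → P x → Q x) where

  length-filter-mono : ∀ xs → length (filter P? xs) ≤ length (filter Q? xs)
  length-filter-mono xs = length-mono-≤ (filter⁺ P? Q? (λ { refl → P⊆Q }) (⊆-refl {x = xs}))

  length-filter-strictMono : ∀ {x} xs → x ∈ xs → Q x → ¬ P x →
                             length (filter P? xs) < length (filter Q? xs)
  length-filter-strictMono (y ∷ xs) (here refl) qy ¬py with P? y | Q? y
  ... | yes py | _      = ⊥-elim (¬py py)
  ... | no _   | no ¬qy = ⊥-elim (¬qy qy)
  ... | no _   | yes _  = s≤s (length-filter-mono xs)
  length-filter-strictMono (y ∷ xs) (there x∈xs) qx ¬px with P? y | Q? y
  ... | yes _  | yes _  = s≤s (length-filter-strictMono xs x∈xs qx ¬px)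
  ... | yes py | no ¬qy = ⊥-elim (¬qy (P⊆Q py))
  ... | no _   | yes _  = ℕ.m<n⇒m<1+n (length-filter-strictMono xs x∈xs qx ¬px)
  ... | no _   | no _   = length-filter-strictMono xs x∈xs qx ¬px

≤-1⇒≢0 : ∀ {i} → i ℤ.≤ -[1+ 0 ] → i ≢ + 0
≤-1⇒≢0 () refl

≢⇒2≤ : ∀ {m} {i j : Fin m} → i ≢ j → 2 ℕ.≤ m
≢⇒2≤ {suc zero}    {Fin.zero} {Fin.zero} i≢j = ⊥-elim (i≢j refl)
≢⇒2≤ {suc (suc _)} _ = s≤s (s≤s z≤n)

/suc-injective : ∀ {a m n} → a ≢ 0 → (+ a) / suc m ≡ (+ a) / suc n → m ≡ n
/suc-injective {zero}      a≢0 _  = ⊥-elim (a≢0 refl)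
/suc-injective {a@(suc _)} {m} {n} _ eq =
  ℕ.suc-injective (ℕ.*-cancelˡ-≡ (suc m) (suc n) a (sym (ℚ.normalize-injective-≃ a a (suc m) (suc n) eq)))

0≡/suc⇒≡0 : ∀ {a m} → 0ℚ ≡ (+ a) / suc m → a ≡ 0
0≡/suc⇒≡0 {a} {m} eq with ℚ./-injective-≃ (mkℚᵘ (+ 0) 0) (mkℚᵘ (+ a) m) (trans (ℚ.0/n≡0 1) eq)
... | *≡* e = sym (ℤ.+-injective (trans e (ℤ.*-identityʳ (+ a))))

/suc≡integer⇒∣ : ∀ {a m} k → (+ a) / suc m ≡ k / 1 → suc m ∣ a
/suc≡integer⇒∣ {a} {m} k eq with ℚ./-injective-≃ (mkℚᵘ (+ a) m) (mkℚᵘ k 0) eq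
... | *≡* e = ∣⇒∣ᵤ (divides k (trans (sym (ℤ.*-identityʳ (+ a))) e))

module _ (L : FiniteLattice) where
  open FiniteLattice L using (n; _≤?_; _∨_; ⊤; ⊥; isBoundedLattice) renaming (_≤_ to _⊑_)
  open IsBoundedLattice isBoundedLattice
    using (maximum; minimum; x≤x∨y; y≤x∨y; ∨-least; antisym)
    renaming (refl to ⊑-refl; trans to ⊑-trans)

  ratio-injective : ∣J∣ L ≢ 0 → ∀ {x y} → ratio L x ≡ ratio L y → ∣J_∣ L x ≡ ∣J_∣ L y
  ratio-injective J≢0 {x} {y} eq with ∣J_∣ L x | ∣J_∣ L y
  ... | zero  | zero  = refl
  ... | zero  | suc _ = ⊥-elim (J≢0 (0≡/suc⇒≡0 eq))
  ... | suc _ | zero  = ⊥-elim (J≢0 (0≡/suc⇒≡0 (sym eq)))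
  ... | suc _ | suc _ = cong suc (/suc-injective J≢0 eq)

  ratio-integer⇒∣ : ∀ {x} → ∣J_∣ L x ≢ 0 → IsInteger L (ratio L x) → ∣J_∣ L x ∣ ∣J∣ L
  ratio-integer⇒∣ {x} Jx≢0 (k , eq) with ∣J_∣ L x
  ... | zero  = ⊥-elim (Jx≢0 refl)
  ... | suc _ = /suc≡integer⇒∣ k eq

  _⊏_ : Rel (Fin n) 0ℓ
  c ⊏ w = c ⊑ w × c ≢ w

  downsetSize : Fin n → ℕ
  downsetSize w = length (filter (_≤? w) (allFin n))

  downsetSize-strictMono : ∀ {c w} → c ⊏ w → downsetSize c < downsetSize w
  downsetSize-strictMono {c} {w} (c⊑w , c≢w) =
    length-filter-strictMono (_≤? c) (_≤? w) (λ t⊑c → ⊑-trans t⊑c c⊑w)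
      (allFin n) (∈-allFin w) ⊑-refl (λ w⊑c → c≢w (antisym c⊑w w⊑c))

  ⊏-wellFounded : WellFounded _⊏_
  ⊏-wellFounded =
    Subrelation.wellFounded downsetSize-strictMono (On.wellFounded downsetSize <-wellFounded)

  private
    split? : ∀ w a b → Dec (w ≡ a ∨ b → (a ≡ w) ⊎ (b ≡ w))
    split? w a b = (w ≟ a ∨ b) →-dec ((a ≟ w) ⊎-dec (b ≟ w))

  ¬joinIrreducible⇒join : ∀ {w} → w ≢ ⊥ → ¬ JoinIrreducible L w →
                          ∃₂ λ a b → w ≡ a ∨ b × a ≢ w × b ≢ w
  ¬joinIrreducible⇒join {w} w≢⊥ ¬ji
    with ¬∀⟶∃¬ n _ (λ a → all? (split? w a)) (λ split → ¬ji (w≢⊥ , split))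
  ... | a , ¬∀split with ¬∀⟶∃¬ n _ (split? w a) ¬∀split
  ... | b , ¬split =
    a , b , decidable-stable (w ≟ a ∨ b) (λ w≢a∨b → ¬split (⊥-elim ∘ w≢a∨b)) ,
    (λ a≡w → ¬split (λ _ → inj₁ a≡w)) , (λ b≡w → ¬split (λ _ → inj₂ b≡w))

  ≰⇒∃joinIrreducible : ∀ {w y} → ¬ w ⊑ y → ∃ λ j → JoinIrreducible L j × j ⊑ w × ¬ j ⊑ y
  ≰⇒∃joinIrreducible {w} = go (⊏-wellFounded w) ⊑-refl
    where
    go : ∀ {w y z} → Acc _⊏_ w → w ⊑ z → ¬ w ⊑ y →
         ∃ λ j → JoinIrreducible L j × j ⊑ z × ¬ j ⊑ y
    go {w} {y} (acc rec) w⊑z w⋠y with joinIrreducible? L w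
    ... | yes ji = w , ji , w⊑z , w⋠y
    ... | no ¬ji with ¬joinIrreducible⇒join (λ { refl → w⋠y (minimum y) }) ¬ji
    ... | a , b , refl , a≢w , b≢w with a ≤? y | b ≤? y
    ... | no a⋠y  | _        = go (rec (x≤x∨y a b , a≢w)) (⊑-trans (x≤x∨y a b) w⊑z) a⋠y
    ... | yes _   | no b⋠y   = go (rec (y≤x∨y a b , b≢w)) (⊑-trans (y≤x∨y a b) w⊑z) b⋠y
    ... | yes a⊑y | yes b⊑y  = ⊥-elim (w⋠y (∨-least a⊑y b⊑y))

  ∣J∣-strictMono : ∀ {y z} → y ⊑ z → ¬ z ⊑ y → ∣J_∣ L y < ∣J_∣ L z
  ∣J∣-strictMono y⊑z z⋠y with ≰⇒∃joinIrreducible z⋠y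
  ... | j , ji , j⊑z , j⋠y =
    length-filter-strictMono _ _ (λ (ji , j⊑y) → ji , ⊑-trans j⊑y y⊑z)
      (allFin n) (∈-allFin j) (ji , j⊑z) (j⋠y ∘ proj₂)

  ∣J⊤∣≡∣J∣ : ∣J_∣ L ⊤ ≡ ∣J∣ L
  ∣J⊤∣≡∣J∣ = cong length (filter-≐ _ _ (proj₁ , λ ji → ji , maximum _) (allFin n))

  ∣J∣≢0 : ∀ {x} → x ≢ ⊥ → ∣J_∣ L x ≢ 0
  ∣J∣≢0 {x} x≢⊥ = ℕ.m<n⇒n≢0 (∣J∣-strictMono (minimum x) (λ x⊑⊥ → x≢⊥ (antisym x⊑⊥ (minimum x))))

  Coatom : Fin n → Set
  Coatom y = y ≢ ⊤ × (∀ {z} → y ⊏ z → z ≡ ⊤)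

  μ-fuel-coatom : ∀ f → 2 ℕ.≤ f → ∀ {y} → Coatom y → μ-fuel L f y ⊤ ℤ.≤ -[1+ 0 ]
  μ-fuel-coatom (suc zero) (s≤s ())
  μ-fuel-coatom (suc (suc k)) _ {y} (y≢⊤ , y⋖⊤) with y ≟ ⊤ | y ≤? ⊤
  ... | yes y≡⊤ | _       = ⊥-elim (y≢⊤ y≡⊤)
  ... | no _    | no y⋠⊤  = ⊥-elim (y⋠⊤ (maximum y))
  ... | no _    | yes _   =
    ℤ.neg-mono-≤ (sum-positive (All.map⁺ (All.tabulate (λ z∈ → ℤ.≤-trans (ℤ.+≤+ z≤n) (≥1 z∈))))
                               (Any.map⁺ (Any.map (λ { refl → ≥1 ⊤∈ }) ⊤∈)))
    where
    above? = λ z → ((y ≤? z) ×-dec ¬? (y ≟ z)) ×-dec (z ≤? ⊤)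
    ⊤∈ : ⊤ ∈ filter above? (allFin n)
    ⊤∈ = ∈-filter⁺ above? (∈-allFin ⊤) ((maximum y , y≢⊤) , maximum ⊤)
    ≥1 : ∀ {z} → z ∈ filter above? (allFin n) → + 1 ℤ.≤ μ-fuel L (suc k) z ⊤
    ≥1 z∈ with y⋖⊤ (proj₁ (proj₂ (∈-filter⁻ above? {xs = allFin n} z∈)))
    ... | refl with ⊤ ≟ ⊤
    ...   | yes _   = ℤ.≤-refl
    ...   | no ⊤≢⊤ = ⊥-elim (⊤≢⊤ refl)

  μ-coatom : ∀ {y} → Coatom y → μ L y ⊤ ℤ.≤ -[1+ 0 ]
  μ-coatom coatom@(y≢⊤ , _) = μ-fuel-coatom n (≢⇒2≤ y≢⊤) coatom

  coeff-negative : ∀ {q x} → x ≢ ⊥ → ratio L x ≡ q →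
                   (∀ {y} → y ≢ ⊥ → ratio L y ≡ q → Coatom y) → coeff L q ℤ.≤ -[1+ 0 ]
  coeff-negative {q} {x} x≢⊥ rx≡q coatoms =
    sum-negative (All.map⁺ (All.tabulate (λ y∈ → ℤ.≤-trans (μ≤-1 y∈) ℤ.-≤+)))
                 (Any.map⁺ (Any.map (λ { refl → μ≤-1 x∈ }) x∈))
    where
    level? = λ y → ¬? (y ≟ ⊥) ×-dec (ratio L y ℚ.≟ q)
    x∈ : x ∈ filter level? (allFin n)
    x∈ = ∈-filter⁺ level? (∈-allFin x) (x≢⊥ , rx≡q)
    μ≤-1 : ∀ {y} → y ∈ filter level? (allFin n) → μ L y ⊤ ℤ.≤ -[1+ 0 ]
    μ≤-1 y∈ = let (y≢⊥ , ry≡q) = proj₂ (∈-filter⁻ level? {xs = allFin n} y∈)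
              in μ-coatom (coatoms y≢⊥ ry≡q)

  maximal-∣J∣-coatom : ∀ {x} → (∀ y → y ≢ ⊥ → y ≢ ⊤ → ∣J_∣ L y ≤ ∣J_∣ L x) →
                       ¬ (∣J_∣ L x ∣ ∣J∣ L) →
                       ∀ {y} → y ≢ ⊥ → ∣J_∣ L y ≡ ∣J_∣ L x → Coatom y
  maximal-∣J∣-coatom {x} maximal ∤ {y} y≢⊥ Jy≡Jx = y≢⊤ , y⋖⊤
    where
    y≢⊤ : y ≢ ⊤
    y≢⊤ refl = ∤ (subst (_∣ ∣J∣ L) (trans (sym ∣J⊤∣≡∣J∣) Jy≡Jx) ∣-refl)
    y⋖⊤ : ∀ {z} → y ⊏ z → z ≡ ⊤
    y⋖⊤ {z} (y⊑z , y≢z) = decidable-stable (z ≟ ⊤) λ z≢⊤ →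
      ℕ.<-irrefl Jy≡Jx (ℕ.<-≤-trans (∣J∣-strictMono y⊑z (y≢z ∘ antisym y⊑z))
                                      (maximal z (λ { refl → y≢⊥ (antisym y⊑z (minimum y)) }) z≢⊤))

mainTheorem3 : (L : FiniteLattice) →
    FiniteLattice.⊥ L ≢ FiniteLattice.⊤ L →
    (x : Fin (FiniteLattice.n L)) →
    x ≢ FiniteLattice.⊥ L → x ≢ FiniteLattice.⊤ L →
    (∀ (y : Fin (FiniteLattice.n L)) → y ≢ FiniteLattice.⊥ L → y ≢ FiniteLattice.⊤ L →
      ∣J_∣ L y ≤ ∣J_∣ L x) →
    ¬ (∣J_∣ L x ∣ ∣J∣ L) →
    ¬ WeaklyCosetLike L
-- x ≢ 1̂ and 0̂ ≢ 1̂ are implied by the other hypotheses.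
mainTheorem3 L _ x x≢⊥ _ maximal ∤ weaklyCosetLike =
  ∤ (ratio-integer⇒∣ L (∣J∣≢0 L x≢⊥) (weaklyCosetLike (ratio L x) coeff≢0))
  where
  J≢0 : ∣J∣ L ≢ 0
  J≢0 J≡0 = ∤ (subst (∣J_∣ L x ∣_) (sym J≡0) (∣J_∣ L x ∣0))
  coeff≢0 : coeff L (ratio L x) ≢ + 0
  coeff≢0 = ≤-1⇒≢0 (coeff-negative L x≢⊥ refl λ y≢⊥ ry≡rx →
    maximal-∣J∣-coatom L maximal ∤ y≢⊥ (ratio-injective L J≢0 ry≡rx))
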